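{- Let $s$ be a string over a finite alphabet $\Sigma$ and let $p$ be a positive integer that is a parameterized period of $s$. Let $s'$ be any substring of $s$ and let $k$ be an integer with $2 \le k \le |\Sigma_s| + 1$. If $|s'| \ge p\cdot(k-2)+1$, then $|\Sigma_{s'}| \ge k-1$.
   Context: For a string $w$, $\Sigma_w$ denotes the set of distinct characters occurring in $w$. Two strings $x,y$ of equal length $k$ are parameterized equivalent, written $x\approx y$, if there is a bijection $f:\Sigma\to\Sigma$ with $f(x[i])=y[i]$ for all $1\le i\le k$. A positive integer $p$ is a parameterized period of $s$ if $s[1..|s|-p] \approx s[p+1..|s|]$, i.e., there is a bijection $f$ of $\Sigma$ with $f(s[i]) = s[i+p]$ for all $1 \le i \le |s|-p$. -}

module Defs where

open import Data.Nat using (ℕ; _∸_)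
open import Data.Fin using (Fin)
open import Data.Fin.Properties using (_≟_)
open import Data.List using (List; length; map; take; drop; deduplicate; _++_)
open import Data.Product using (∃; ∃-syntax; _×_; Σ-syntax)
open import Function.Bundles using (_⤖_; Bijection)
open import Relation.Binary.PropositionalEquality using (_≡_)

Str : ℕ → Set
Str σ = List (Fin σ)

distinctCount : ∀ {σ} → Str σ → ℕ
distinctCount w = length (deduplicate _≟_ w)

-- x ≈ y : parameterized equivalence (a bijection f of Σ with f(x[i]) = y[i] for all i;
-- map f x ≡ y also forces |x| = |y|).
_≈ₚ_ : ∀ {σ} → Str σ → Str σ → Set
_≈ₚ_ {σ} x y = Σ[ f ∈ (Fin σ ⤖ Fin σ) ] (map (Bijection.to f) x ≡ y)

IsParamPeriod : ∀ {σ} → ℕ → Str σ → Set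
IsParamPeriod p s = take (length s ∸ p) s ≈ₚ drop p s

IsSubstring : ∀ {σ} → Str σ → Str σ → Set
IsSubstring s' s = ∃[ u ] ∃[ v ] (s ≡ u ++ s' ++ v)

{-# OPTIONS --safe #-}
-- Let f be the injection realising the period, so that s[j + p] = f (s[j]), and grow a window of s
-- by p letters at a time. If a step adds no new letter, the letter set X of the window satisfies
-- f X ⊆ X, hence f X = X because f is injective and X is finite. X then contains p consecutive
-- letters of s and is closed under f and f⁻¹, so walking along ±p it contains every letter of s.
-- Thus every step adds a letter until the window uses all of Σ_s, and a window of length
-- (k − 2) p + 1 has at least min (k − 1, |Σ_s|) distinct letters.
module Submission where

open import Defs
open import Data.Nat using (ℕ; zero; suc; _+_; _*_; _∸_; _≤_; _<_; _⊓_; z≤n; s≤s; s≤s⁻¹; _≤?_)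
open import Data.Nat.Properties
  using ( ≤-refl; ≤-reflexive; ≤-trans; <⇒≤; ≰⇒>; n≤1+n; n<1+n; m<n⇒m<1+n; m≤n⇒m<n∨m≡n
        ; m<m+n; m≤m+n; m≤n+m; +-comm; +-assoc; *-comm; +-monoʳ-≤; +-cancelˡ-≤
        ; m+n≤o⇒m≤o∸n; m≤n+o⇒m∸n≤o; m∸n+n≡m; m≤n⇒∃[o]m+o≡n; 1+n≰n
        ; +-commutativeSemigroup; m⊓n≤m; m⊓n≤n; ⊓-monoʳ-≤; m≤n⇒m⊓n≡m; module ≤-Reasoning )
open import Data.Fin.Properties using (_≟_)
open import Algebra.Properties.CommutativeSemigroup +-commutativeSemigroup using (xy∙z≈xz∙y)
open import Data.List using (List; []; _∷_; length; map; take; drop; deduplicate; _++_)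
open import Data.List.Properties using (length-map; length-++; take-map; drop-map; drop-drop; take-drop; take-take)
open import Data.List.Membership.Propositional using (_∈_; _∉_; find)
open import Data.List.Membership.Propositional.Properties using (∈-map⁺; ∈-map⁻; ∈-∃++; ∈-deduplicate⁺; ∈-deduplicate⁻)
open import Data.List.Membership.DecPropositional using (_∈?_)
open import Data.List.Relation.Binary.Subset.Propositional using (_⊆_)
open import Data.List.Relation.Binary.Subset.Propositional.Properties using (⊆∷∧∉⇒⊆; ⊆-respʳ-↭; ∈-∷⁺ʳ; map⁺)
open import Data.List.Relation.Binary.Permutation.Propositional.Properties using (shift; ↭-length)
import Data.List.Relation.Binary.Sublist.Propositional.Properties as Sublist
open import Data.List.Relation.Unary.Any using (here; there)
open import Data.List.Relation.Unary.All as All using (all?)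
open import Data.List.Relation.Unary.All.Properties using (¬Any⇒All¬; ¬All⇒Any¬)
open import Data.List.Relation.Unary.AllPairs using ([]; _∷_)
open import Data.List.Relation.Unary.Unique.Propositional using (Unique)
open import Data.List.Relation.Unary.Unique.Propositional.Properties as Uniqueₚ using (Unique[x∷xs]⇒x∉xs)
open import Data.List.Relation.Unary.Unique.DecPropositional.Properties using (deduplicate-!)
open import Data.Product using (∃-syntax; _×_; _,_)
open import Data.Sum using (_⊎_; inj₁; inj₂)
open import Function using (_∘_; _⇔_; mk⇔; Equivalence; Bijection)
open import Function.Definitions using (Injective)
open import Relation.Binary.Definitions using (DecidableEquality)
open import Relation.Binary.PropositionalEquality using (_≡_; refl; sym; trans; cong; subst; module ≡-Reasoning)
open import Relation.Nullary using (yes; no; contradiction)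

module _ {a} {A : Set a} where

  unique-⊆⇒length≤ : ∀ {xs ys : List A} → Unique xs → xs ⊆ ys → length xs ≤ length ys
  unique-⊆⇒length≤ [] _ = z≤n
  unique-⊆⇒length≤ {x ∷ xs} {ys} (x≢xs ∷ !xs) x∷xs⊆ys with ys₁ , ys₂ , refl ← ∈-∃++ (x∷xs⊆ys (here refl)) =
    begin
      suc (length xs)             ≤⟨ s≤s (unique-⊆⇒length≤ !xs xs⊆ys₁++ys₂) ⟩
      suc (length (ys₁ ++ ys₂))   ≡⟨ ↭-length (shift x ys₁ ys₂) ⟨
      length ys                   ∎
    where
    open ≤-Reasoning
    xs⊆ys₁++ys₂ : xs ⊆ ys₁ ++ ys₂
    xs⊆ys₁++ys₂ = ⊆∷∧∉⇒⊆ (⊆-respʳ-↭ (shift x ys₁ ys₂) (x∷xs⊆ys ∘ there)) (Unique[x∷xs]⇒x∉xs (x≢xs ∷ !xs))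

  slice : ℕ → ℕ → List A → List A
  slice i m xs = take m (drop i xs)

  slice-map : ∀ {f : A → A} i m xs → slice i m (map f xs) ≡ map f (slice i m xs)
  slice-map i m xs = trans (cong (take m) (drop-map i xs)) (take-map m (drop i xs))

  slice-take : ∀ {i m n} (xs : List A) → i + m ≤ n → slice i m (take n xs) ≡ slice i m xs
  slice-take {i} {m} {n} xs i+m≤n = begin
    take m (drop i (take n xs))        ≡⟨ take-drop m i (take n xs) ⟩
    drop i (take (i + m) (take n xs))  ≡⟨ cong (drop i) (take-take (i + m) n xs) ⟩
    drop i (take ((i + m) ⊓ n) xs)     ≡⟨ cong (λ k → drop i (take k xs)) (m≤n⇒m⊓n≡m i+m≤n) ⟩
    drop i (take (i + m) xs)           ≡⟨ take-drop m i xs ⟨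
    take m (drop i xs)                 ∎
    where open ≡-Reasoning

  slice-⊆ : ∀ {i j m n} (xs : List A) → i ≤ j → j + m ≤ i + n → slice j m xs ⊆ slice i n xs
  slice-⊆ {i} {m = m} {n} xs i≤j j+m≤i+n with d , refl ← m≤n⇒∃[o]m+o≡n i≤j =
    Sublist.Any-resp-⊆ (Sublist.take⁺ d+m≤n) ∘ Sublist.Any-resp-⊆ (Sublist.drop-⊆ d _) ∘ subst (_ ∈_) as-drop-take
    where
    d+m≤n : d + m ≤ n
    d+m≤n = +-cancelˡ-≤ i _ _ (subst (_≤ i + n) (+-assoc i d m) j+m≤i+n)
    as-drop-take : slice (i + d) m xs ≡ drop d (take (d + m) (drop i xs))
    as-drop-take = trans (cong (take m) (sym (drop-drop i d xs))) (take-drop m d (drop i xs))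

  slice-⊆ʳ : ∀ {i m n} (xs : List A) → m ≤ n → slice i m xs ⊆ slice i n xs
  slice-⊆ʳ {i} xs m≤n = slice-⊆ xs ≤-refl (+-monoʳ-≤ i m≤n)

  slice-length-++ : ∀ (u w v : List A) → slice (length u) (length w) (u ++ w ++ v) ≡ w
  slice-length-++ (x ∷ u) w       v = slice-length-++ u w v
  slice-length-++ []      []      v = refl
  slice-length-++ []      (x ∷ w) v = cong (x ∷_) (slice-length-++ [] w v)

  length-++-++ : ∀ (u w v : List A) → length u + length w ≤ length (u ++ w ++ v)
  length-++-++ u w v = begin
    length u + length w                ≤⟨ +-monoʳ-≤ (length u) (m≤m+n (length w) (length v)) ⟩
    length u + (length w + length v)   ≡⟨ cong (length u +_) (length-++ w) ⟨
    length u + length (w ++ v)         ≡⟨ length-++ u ⟨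
    length (u ++ w ++ v)               ∎
    where open ≤-Reasoning

  ∈-slice⁺ : ∀ {i} {xs : List A} → i < length xs → ∃[ x ] x ∈ slice i 1 xs
  ∈-slice⁺ {zero}  {x ∷ xs} _          = x , here refl
  ∈-slice⁺ {suc i} {x ∷ xs} (s≤s i<n) = ∈-slice⁺ i<n

  ∈-slice⁻ : ∀ {x} {xs : List A} → x ∈ xs → ∃[ i ] i < length xs × x ∈ slice i 1 xs
  ∈-slice⁻ (here refl) = 0 , s≤s z≤n , here refl
  ∈-slice⁻ (there x∈xs) with i , i<n , x∈ ← ∈-slice⁻ x∈xs = suc i , s≤s i<n , x∈

module _ {a} {A : Set a} (_≟_ : DecidableEquality A) where

  deduplicate-length-mono : ∀ {xs ys : List A} → xs ⊆ ys →
                            length (deduplicate _≟_ xs) ≤ length (deduplicate _≟_ ys)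
  deduplicate-length-mono {xs} xs⊆ys =
    unique-⊆⇒length≤ (deduplicate-! _≟_ xs) (∈-deduplicate⁺ _≟_ ∘ xs⊆ys ∘ ∈-deduplicate⁻ _≟_ xs)

  deduplicate-length-mono-< : ∀ {xs ys : List A} {y} → xs ⊆ ys → y ∈ ys → y ∉ xs →
                              length (deduplicate _≟_ xs) < length (deduplicate _≟_ ys)
  deduplicate-length-mono-< {xs} xs⊆ys y∈ys y∉xs =
    unique-⊆⇒length≤ (¬Any⇒All¬ _ (y∉xs ∘ ∈-deduplicate⁻ _≟_ xs) ∷ deduplicate-! _≟_ xs)
                     (∈-deduplicate⁺ _≟_ ∘ ∈-∷⁺ʳ y∈ys (xs⊆ys ∘ ∈-deduplicate⁻ _≟_ xs))

  -- Counting: otherwise z ∷ map f (deduplicate xs) would be a longer duplicate-free list inside xs.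
  injective-self-map-onto : ∀ {f : A → A} {xs} → Injective _≡_ _≡_ f → map f xs ⊆ xs → xs ⊆ map f xs
  injective-self-map-onto {f} {xs} f-injective f[xs]⊆xs {z} z∈xs with _∈?_ _≟_ z (map f xs)
  ... | yes z∈f[xs] = z∈f[xs]
  ... | no  z∉f[xs] = contradiction (subst (_≤ length dedup) (cong suc (length-map f dedup)) too-many) 1+n≰n
    where
    dedup : List A
    dedup = deduplicate _≟_ xs
    f[dedup]⊆f[xs] : map f dedup ⊆ map f xs
    f[dedup]⊆f[xs] = map⁺ f (∈-deduplicate⁻ _≟_ xs)
    too-many : suc (length (map f dedup)) ≤ length dedup
    too-many = unique-⊆⇒length≤
      (¬Any⇒All¬ _ (z∉f[xs] ∘ f[dedup]⊆f[xs]) ∷ Uniqueₚ.map⁺ f-injective (deduplicate-! _≟_ xs))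
      (∈-deduplicate⁺ _≟_ ∘ ∈-∷⁺ʳ z∈xs (f[xs]⊆xs ∘ f[dedup]⊆f[xs]))

  injective-self-map-reflects-∈ : ∀ {f : A → A} {xs} → Injective _≡_ _≡_ f → map f xs ⊆ xs →
                                  ∀ {x} → f x ∈ xs → x ∈ xs
  injective-self-map-reflects-∈ {f} {xs} f-injective f[xs]⊆xs fx∈xs
    with y , y∈xs , fx≡fy ← ∈-map⁻ f (injective-self-map-onto f-injective f[xs]⊆xs fx∈xs) =
    subst (_∈ xs) (sym (f-injective fx≡fy)) y∈xs

Block : ∀ {ℓ} → (ℕ → Set ℓ) → ℕ → ℕ → Set ℓ
Block Q p b = ∀ {j} → b ≤ j → j < b + p → Q j

module _ {ℓ} (Q : ℕ → Set ℓ) {p n : ℕ} (0<p : 0 < p)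
         (Q-periodic : ∀ {j} → j + p < n → Q j ⇔ Q (j + p)) where

  block-suc : ∀ {b} → b + p < n → Block Q p b → Block Q p (suc b)
  block-suc {b} b+p<n block {j} b<j j<1+b+p with m≤n⇒m<n∨m≡n (s≤s⁻¹ j<1+b+p)
  ... | inj₁ j<b+p = block (<⇒≤ b<j) j<b+p
  ... | inj₂ refl  = Equivalence.to (Q-periodic b+p<n) (block ≤-refl (m<m+n b 0<p))

  block-pred : ∀ {b} → b + p < n → Block Q p (suc b) → Block Q p b
  block-pred {b} b+p<n block {j} b≤j j<b+p with m≤n⇒m<n∨m≡n b≤j
  ... | inj₁ b<j  = block b<j (m<n⇒m<1+n j<b+p)
  ... | inj₂ refl = Equivalence.from (Q-periodic b+p<n) (block (m<m+n b 0<p) (n<1+n (b + p)))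

  block⇒block-0 : ∀ b → b + p ≤ n → Block Q p b → Block Q p 0
  block⇒block-0 zero    _       block = block
  block⇒block-0 (suc b) b+p<n   block = block⇒block-0 b (<⇒≤ b+p<n) (block-pred b+p<n block)

  block-0⇒block : ∀ b → b + p ≤ n → Block Q p 0 → Block Q p b
  block-0⇒block zero    _     block = block
  block-0⇒block (suc b) b+p<n block = block-suc b+p<n (block-0⇒block b (<⇒≤ b+p<n) block)

  block⇒block : ∀ {a b} → a + p ≤ n → b + p ≤ n → Block Q p a → Block Q p b
  block⇒block {a} {b} a+p≤n b+p≤n = block-0⇒block b b+p≤n ∘ block⇒block-0 a a+p≤n

  block⇒all : ∀ {a} → a + p ≤ n → Block Q p a → ∀ {j} → j < n → Q j
  block⇒all {a} a+p≤n block {j} j<n with j + p ≤? n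
  ... | yes j+p≤n = block⇒block a+p≤n j+p≤n block ≤-refl (m<m+n j 0<p)
  ... | no  j+p≰n = block⇒block a+p≤n (≤-reflexive n∸p+p≡n) block
                      (m≤n+o⇒m∸n≤o n p (≤-trans (<⇒≤ (≰⇒> j+p≰n)) (≤-reflexive (+-comm j p))))
                      (subst (j <_) (sym n∸p+p≡n) j<n)
    where
    n∸p+p≡n : n ∸ p + p ≡ n
    n∸p+p≡n = m∸n+n≡m (≤-trans (m≤n+m p a) a+p≤n)

module ParamPeriodic {A : Set} (_≟_ : DecidableEquality A) (f : A → A) (f-injective : Injective _≡_ _≡_ f)
                     (s : List A) {p} (0<p : 0 < p) (period : map f (take (length s ∸ p) s) ≡ drop p s) where

  ∣_∣ : List A → ℕ
  ∣ xs ∣ = length (deduplicate _≟_ xs)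

  slice-shift : ∀ {i m} → i + p + m ≤ length s → slice (i + p) m s ≡ map f (slice i m s)
  slice-shift {i} {m} i+p+m≤n = begin
    slice (i + p) m s                          ≡⟨ cong (λ k → slice k m s) (+-comm i p) ⟩
    take m (drop (p + i) s)                    ≡⟨ cong (take m) (drop-drop p i s) ⟨
    slice i m (drop p s)                       ≡⟨ cong (slice i m) period ⟨
    slice i m (map f (take (length s ∸ p) s))  ≡⟨ slice-map i m _ ⟩
    map f (slice i m (take (length s ∸ p) s))  ≡⟨ cong (map f) (slice-take s i+m≤n∸p) ⟩
    map f (slice i m s)                        ∎
    where
    open ≡-Reasoning
    i+m≤n∸p : i + m ≤ length s ∸ p
    i+m≤n∸p = m+n≤o⇒m≤o∸n (i + m) (subst (_≤ length s) (xy∙z≈xz∙y i p m) i+p+m≤n)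

  stable-slice-covers : ∀ {a m} → a + (p + m) ≤ length s → slice a (p + m) s ⊆ slice a m s → s ⊆ slice a m s
  stable-slice-covers {a} {m} a+p+m≤n stable x∈s with j , j<n , x∈ ← ∈-slice⁻ x∈s =
    block⇒all Q 0<p Q-periodic (≤-trans (+-monoʳ-≤ a (m≤m+n p m)) a+p+m≤n) block j<n x∈
    where
    X : List A
    X = slice a m s
    f[X]⊆X : map f X ⊆ X
    f[X]⊆X = stable ∘ slice-⊆ s (m≤m+n a p) (≤-reflexive (+-assoc a p m)) ∘ subst (_ ∈_) (sym shifted)
      where
      shifted : slice (a + p) m s ≡ map f X
      shifted = slice-shift (subst (_≤ length s) (sym (+-assoc a p m)) a+p+m≤n)
    Q : ℕ → Set
    Q j = slice j 1 s ⊆ X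
    Q-periodic : ∀ {j} → j + p < length s → Q j ⇔ Q (j + p)
    Q-periodic {j} j+p<n = mk⇔ forward backward
      where
      step : slice (j + p) 1 s ≡ map f (slice j 1 s)
      step = slice-shift (subst (_≤ length s) (+-comm 1 (j + p)) j+p<n)
      forward : Q j → Q (j + p)
      forward Qj = f[X]⊆X ∘ map⁺ f Qj ∘ subst (_ ∈_) step
      backward : Q (j + p) → Q j
      backward Qj+p = injective-self-map-reflects-∈ _≟_ f-injective f[X]⊆X
                    ∘ Qj+p ∘ subst (_ ∈_) (sym step) ∘ ∈-map⁺ f
    block : Block Q p a
    block {j} a≤j j<a+p = stable ∘ slice-⊆ s a≤j
      (≤-trans (≤-reflexive (+-comm j 1)) (≤-trans j<a+p (+-monoʳ-≤ a (m≤m+n p m))))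

  slice-grows-or-covers : ∀ {a m} → a + (p + m) ≤ length s →
                          s ⊆ slice a m s ⊎ ∣ slice a m s ∣ < ∣ slice a (p + m) s ∣
  slice-grows-or-covers {a} {m} a+p+m≤n with all? (λ x → _∈?_ _≟_ x (slice a m s)) (slice a (p + m) s)
  ... | yes stable  = inj₁ (stable-slice-covers {a} {m} a+p+m≤n (All.lookup stable))
  ... | no unstable with x , x∈ , x∉ ← find (¬All⇒Any¬ (λ x → _∈?_ _≟_ x (slice a m s)) _ unstable) =
    inj₂ (deduplicate-length-mono-< _≟_ (slice-⊆ʳ {i = a} s (m≤n+m m p)) x∈ x∉)

  distinct-slice-step : ∀ {a m} k → a + (p + m) ≤ length s →
                        k ⊓ ∣ s ∣ ≤ ∣ slice a m s ∣ → suc k ⊓ ∣ s ∣ ≤ ∣ slice a (p + m) s ∣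
  distinct-slice-step {a} {m} k a+p+m≤n k⊓∣s∣≤ with slice-grows-or-covers {a} {m} a+p+m≤n
  ... | inj₁ covers = begin
    suc k ⊓ ∣ s ∣          ≤⟨ m⊓n≤n (suc k) ∣ s ∣ ⟩
    ∣ s ∣                  ≤⟨ deduplicate-length-mono _≟_ covers ⟩
    ∣ slice a m s ∣        ≤⟨ deduplicate-length-mono _≟_ (slice-⊆ʳ {i = a} s (m≤n+m m p)) ⟩
    ∣ slice a (p + m) s ∣  ∎
    where open ≤-Reasoning
  ... | inj₂ grows = begin
    suc k ⊓ ∣ s ∣          ≤⟨ ⊓-monoʳ-≤ (suc k) (n≤1+n ∣ s ∣) ⟩
    suc (k ⊓ ∣ s ∣)        ≤⟨ s≤s k⊓∣s∣≤ ⟩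
    suc ∣ slice a m s ∣    ≤⟨ grows ⟩
    ∣ slice a (p + m) s ∣  ∎
    where open ≤-Reasoning

  distinct-window : ∀ {a} i → a + (i * p + 1) ≤ length s → suc i ⊓ ∣ s ∣ ≤ ∣ slice a (i * p + 1) s ∣
  distinct-window {a} zero a+1≤n with x , x∈ ← ∈-slice⁺ (subst (_≤ length s) (+-comm a 1) a+1≤n) =
    ≤-trans (m⊓n≤m 1 ∣ s ∣) (deduplicate-length-mono-< _≟_ {[]} (λ ()) x∈ λ ())
  distinct-window {a} (suc i) bound rewrite +-assoc p (i * p) 1 =
    distinct-slice-step {a} (suc i) bound
      (distinct-window {a} i (≤-trans (+-monoʳ-≤ a (m≤n+m (i * p + 1) p)) bound))

lemma8 : ∀ {σ} (s s' : Str σ) (p k : ℕ) →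
    1 ≤ p → IsParamPeriod p s → IsSubstring s' s →
    2 ≤ k → k ≤ distinctCount s + 1 →
    p * (k ∸ 2) + 1 ≤ length s' →
    k ∸ 1 ≤ distinctCount s'
lemma8 _ _ _ zero _ _ _ () _ _
lemma8 _ _ _ (suc zero) _ _ _ (s≤s ()) _ _
lemma8 {σ} .(u ++ s' ++ v) s' p (suc (suc t)) 0<p (f , period) (u , v , refl) _ k≤∣s∣+1 p*t+1≤∣s'∣ = begin
  suc t                                      ≡⟨ m≤n⇒m⊓n≡m t<∣s∣ ⟨
  suc t ⊓ distinctCount s                    ≤⟨ distinct-window {length u} t window-fits ⟩
  distinctCount (slice (length u) w-len s)   ≤⟨ deduplicate-length-mono _≟_ window⊆s' ⟩
  distinctCount s'                           ∎
  where
  open ≤-Reasoning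
  s : Str σ
  s = u ++ s' ++ v
  open ParamPeriodic _≟_ (Bijection.to f) (Bijection.injective f) s 0<p period
  w-len : ℕ
  w-len = t * p + 1
  w-len≤∣s'∣ : w-len ≤ length s'
  w-len≤∣s'∣ = subst (λ x → x + 1 ≤ length s') (*-comm p t) p*t+1≤∣s'∣
  t<∣s∣ : suc t ≤ distinctCount s
  t<∣s∣ = s≤s⁻¹ (subst (suc (suc t) ≤_) (+-comm (distinctCount s) 1) k≤∣s∣+1)
  window-fits : length u + w-len ≤ length s
  window-fits = ≤-trans (+-monoʳ-≤ (length u) w-len≤∣s'∣) (length-++-++ u s' v)
  window⊆s' : slice (length u) w-len s ⊆ s'
  window⊆s' = subst (slice (length u) w-len s ⊆_) (slice-length-++ u s' v) (slice-⊆ʳ {i = length u} s w-len≤∣s'∣)
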